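{- Let $D$ be an optimal orientation of a connected graph $G$ of order at least $3$. Then no arc of $D$ is oriented from a source to a sink.
   Context: Graphs are finite and simple. An orientation of $G$ is obtained by directing each edge. For a digraph $D$ and distinct vertices $u,v$, $\kappa_D(u,v)$ is the maximum number of internally disjoint directed $u$--$v$ paths; for $D$ of order $n$, $\bar{\kappa}(D)=\frac{1}{n(n-1)}\sum_{(u,v)}\kappa_D(u,v)$ over ordered pairs of distinct vertices. An orientation $D$ of $G$ is optimal if $\bar{\kappa}(D)$ is maximum over all orientations of $G$. A source is a vertex of in-degree $0$; a sink is a vertex of out-degree $0$. -}

module Defs where

open import Data.Nat using (ℕ; zero; suc; _+_; _≤_)
open import Data.Fin using (Fin; zero; suc; _≟_)
open import Data.Bool using (Bool; true; false)
open import Data.List using (List; []; _∷_; _++_)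
open import Data.List.Membership.Propositional using (_∈_)
open import Data.List.Relation.Unary.Unique.Propositional using (Unique)
open import Data.Product using (Σ; _×_; _,_)
open import Data.Sum using (_⊎_)
open import Data.Empty using (⊥)
open import Relation.Nullary using (¬_; yes; no)
open import Relation.Binary.PropositionalEquality using (_≡_; _≢_)

record Graph (n : ℕ) : Set where
  field
    adj     : Fin n → Fin n → Bool
    symm    : ∀ u v → adj u v ≡ adj v u
    irrefl  : ∀ u → adj u u ≡ false
open Graph public

data Reach {n : ℕ} (G : Graph n) : Fin n → Fin n → Set where
  here : ∀ {u} → Reach G u u
  step : ∀ {u w v} → adj G u w ≡ true → Reach G w v → Reach G u v

Connected : ∀ {n} → Graph n → Set
Connected G = ∀ u v → Reach G u v

record Orientation {n : ℕ} (G : Graph n) : Set where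
  field
    arc      : Fin n → Fin n → Bool
    arc-edge : ∀ u v → arc u v ≡ true → adj G u v ≡ true
    edge-arc : ∀ u v → adj G u v ≡ true → (arc u v ≡ true) ⊎ (arc v u ≡ true)
    antisym  : ∀ u v → arc u v ≡ true → arc v u ≡ true → ⊥
open Orientation public

module _ {n : ℕ} {G : Graph n} (D : Orientation G) where

  data PathVia : Fin n → Fin n → List (Fin n) → Set where
    direct : ∀ {u v} → arc D u v ≡ true → PathVia u v []
    via    : ∀ {u w v xs} → arc D u w ≡ true → PathVia w v xs → PathVia u v (w ∷ xs)

  IsPath : Fin n → Fin n → List (Fin n) → Set
  IsPath u v xs = PathVia u v xs × Unique (u ∷ xs ++ (v ∷ []))

  HasDisjointPaths : Fin n → Fin n → ℕ → Set
  HasDisjointPaths u v k =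
    Σ (Fin k → List (Fin n)) λ ps →
      (∀ i → IsPath u v (ps i)) ×
      (∀ i j → i ≢ j → ps i ≢ ps j × (∀ x → x ∈ ps i → x ∈ ps j → ⊥))

  IsKappa : Fin n → Fin n → ℕ → Set
  IsKappa u v k = HasDisjointPaths u v k × (∀ m → HasDisjointPaths u v m → m ≤ k)

  KappaFun : (Fin n → Fin n → ℕ) → Set
  KappaFun κf = ∀ u v → u ≢ v → IsKappa u v (κf u v)

  IsSource : Fin n → Set
  IsSource u = ∀ w → arc D w u ≡ false

  IsSink : Fin n → Set
  IsSink u = ∀ w → arc D u w ≡ false

sumFin : ∀ n → (Fin n → ℕ) → ℕ
sumFin zero    f = 0
sumFin (suc n) f = f zero + sumFin n (λ i → f (suc i))

pairSum : ∀ {n} → (Fin n → Fin n → ℕ) → ℕ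
pairSum {n} κf = sumFin n λ u → sumFin n λ v → h u v
  where
  h : Fin n → Fin n → ℕ
  h u v with u ≟ v
  ... | yes _ = 0
  ... | no  _ = κf u v

-- D is optimal: its total connectivity Σ κ_D(u,v) (= n(n-1)·κ̄(D), n fixed)
-- is at least that of every orientation D' of G.
Optimal : ∀ {n} {G : Graph n} → Orientation G → Set
Optimal {n} {G} D =
  ∀ (D' : Orientation G) (κ κ' : Fin n → Fin n → ℕ) →
    KappaFun D κ → KappaFun D' κ' → pairSum κ' ≤ pairSum κ

-- Reverse the arc u → v from the source u to the sink v. Since u has no in-arcs and v no
-- out-arcs, the arc u → v lies on no directed path except the direct one, so κ(x, y) does
-- not drop for (x, y) ≠ (u, v), and κ(u, v) drops by at most one. On the other hand κ(v, u)
-- rises from 0 to 1; and as G is connected with a third vertex, some t ∉ {u, v} is adjacent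
-- to u or v, so that κ(v, t) (via v → u → t) or κ(t, u) (via t → v → u) also rises from 0.
-- The total therefore increases, contradicting optimality. The functions κ are given only
-- by a maximality property, so they exist only under double negation, which suffices for
-- this negative conclusion.
module Submission where

open import Defs
open import Data.Nat using (ℕ; zero; suc; _+_; _*_; _≤_; _<_; z≤n; s≤s)
open import Data.Nat.Properties
  using (+-mono-≤; +-identityʳ; +-comm; *-zeroʳ; *-identityʳ; *-distribˡ-+; ≤-pred; ≤∧≢⇒<; ≤⇒≯; +-commutativeSemigroup)
open import Algebra.Properties.CommutativeSemigroup +-commutativeSemigroup using (interchange)
open import Data.Fin using (Fin; zero; suc; _≟_; punchIn; punchOut)
open import Data.Fin.Properties using (injective⇒≤; sequence; any?; punchInᵢ≢i; punchIn-injective; punchIn-punchOut)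
open import Data.List using (List; []; _∷_)
open import Data.List.Membership.Propositional using (_∈_)
open import Data.List.Relation.Unary.All as All using ([]; _∷_)
open import Data.List.Relation.Unary.All.Properties using (++⁻ʳ)
open import Data.List.Relation.Unary.Any using (here)
open import Data.List.Relation.Unary.AllPairs using ([]; _∷_)
open import Data.Bool using (Bool; true; false)
open import Data.Sum as Sum using (_⊎_; inj₁; inj₂)
open import Data.Empty using (⊥)
open import Data.Product as Product using (Σ; _×_; _,_; proj₁; proj₂; ∃; ∃₂; swap)
open import Data.Product.Properties using (≡-dec)
open import Relation.Nullary using (¬_; Dec; yes; no; contradiction; ¬¬-excluded-middle; _⊎-dec_)
open import Relation.Nullary.Negation using (¬¬-Monad)
open import Effect.Monad using (RawMonad)
open import Level using (0ℓ)
open import Relation.Binary.PropositionalEquality using (_≡_; _≢_; refl; sym; trans; cong; cong₂; subst; subst₂; ≢-sym)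

sumFin-cong : ∀ n {f g : Fin n → ℕ} → (∀ i → f i ≡ g i) → sumFin n f ≡ sumFin n g
sumFin-cong zero    f≡g = refl
sumFin-cong (suc n) f≡g = cong₂ _+_ (f≡g zero) (sumFin-cong n (λ i → f≡g (suc i)))

sumFin-mono : ∀ n {f g : Fin n → ℕ} → (∀ i → f i ≤ g i) → sumFin n f ≤ sumFin n g
sumFin-mono zero    f≤g = z≤n
sumFin-mono (suc n) f≤g = +-mono-≤ (f≤g zero) (sumFin-mono n (λ i → f≤g (suc i)))

sumFin-+ : ∀ n (f g : Fin n → ℕ) → sumFin n (λ i → f i + g i) ≡ sumFin n f + sumFin n g
sumFin-+ zero    f g = refl
sumFin-+ (suc n) f g =
  trans (cong (f zero + g zero +_) (sumFin-+ n (λ i → f (suc i)) (λ i → g (suc i))))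
        (interchange (f zero) (g zero) _ _)

sumFin-* : ∀ n c (f : Fin n → ℕ) → sumFin n (λ i → c * f i) ≡ c * sumFin n f
sumFin-* zero    c f = sym (*-zeroʳ c)
sumFin-* (suc n) c f =
  trans (cong (c * f zero +_) (sumFin-* n c (λ i → f (suc i))))
        (sym (*-distribˡ-+ c (f zero) _))

sumFin-0 : ∀ n → sumFin n (λ _ → 0) ≡ 0
sumFin-0 zero    = refl
sumFin-0 (suc n) = sumFin-0 n

δ : ∀ {n} → Fin n → Fin n → ℕ
δ zero    zero    = 1
δ zero    (suc _) = 0
δ (suc _) zero    = 0
δ (suc i) (suc j) = δ i j

δ-refl : ∀ {n} (i : Fin n) → δ i i ≡ 1
δ-refl zero    = refl
δ-refl (suc i) = δ-refl i

δ-≢ : ∀ {n} {i j : Fin n} → i ≢ j → δ i j ≡ 0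
δ-≢ {i = zero}  {zero}  i≢j = contradiction refl i≢j
δ-≢ {i = zero}  {suc j} _   = refl
δ-≢ {i = suc i} {zero}  _   = refl
δ-≢ {i = suc i} {suc j} i≢j = δ-≢ (λ i≡j → i≢j (cong suc i≡j))

sumFin-δ : ∀ n (i : Fin n) → sumFin n (δ i) ≡ 1
sumFin-δ (suc n) zero    = cong suc (sumFin-0 n)
sumFin-δ (suc n) (suc i) = sumFin-δ n i

doubleSum : ∀ {n} → (Fin n → Fin n → ℕ) → ℕ
doubleSum {n} f = sumFin n λ x → sumFin n λ y → f x y

pointMass : ∀ {n} → Fin n × Fin n → Fin n → Fin n → ℕ
pointMass (a , b) x y = δ a x * δ b y

pointMass-refl : ∀ {n} (a b : Fin n) → pointMass (a , b) a b ≡ 1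
pointMass-refl a b = cong₂ _*_ (δ-refl a) (δ-refl b)

pointMass-≢ : ∀ {n} {p : Fin n × Fin n} {x y} → (x , y) ≢ p → pointMass p x y ≡ 0
pointMass-≢ {p = a , b} {x} {y} xy≢ab with a ≟ x
... | no a≢x    = cong (_* δ b y) (δ-≢ a≢x)
... | yes refl  = trans (cong (δ a x *_) (δ-≢ (λ b≡y → xy≢ab (cong (x ,_) (sym b≡y)))))
                        (*-zeroʳ (δ a x))

doubleSum-pointMass : ∀ {n} (p : Fin n × Fin n) → doubleSum (pointMass p) ≡ 1
doubleSum-pointMass {n} (a , b) =
  trans (sumFin-cong n (λ x → trans (sumFin-* n (δ a x) (δ b)) (cong (δ a x *_) (sumFin-δ n b))))
        (trans (sumFin-cong n (λ x → *-identityʳ (δ a x))) (sumFin-δ n a))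

-- pairSum sums a summand bound in a where-block of Defs; it is recovered here by unification.
pairSum-summand : ∀ {n} (κ : Fin n → Fin n → ℕ) → Σ (Fin n → Fin n → ℕ) λ h → pairSum κ ≡ doubleSum h
pairSum-summand κ = _ , refl

offDiagonal : ∀ {n} → (Fin n → Fin n → ℕ) → Fin n → Fin n → ℕ
offDiagonal κ = proj₁ (pairSum-summand κ)

pairSum-mono : ∀ {n} {f g : Fin n → Fin n → ℕ} →
  (∀ x y → x ≢ y → f x y ≤ g x y) → pairSum f ≤ pairSum g
pairSum-mono {n} {f} {g} f≤g = sumFin-mono n λ x → sumFin-mono n λ y → offDiagonal-≤ x y
  where
  offDiagonal-≤ : ∀ x y → offDiagonal f x y ≤ offDiagonal g x y
  offDiagonal-≤ x y with x ≟ y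
  ... | yes _   = z≤n
  ... | no x≢y  = f≤g x y x≢y

pairSum-+ : ∀ {n} (f g : Fin n → Fin n → ℕ) →
  pairSum (λ x y → f x y + g x y) ≡ pairSum f + pairSum g
pairSum-+ {n} f g =
  trans (sumFin-cong n λ x → trans (sumFin-cong n (offDiagonal-+ x)) (sumFin-+ n _ _))
        (sumFin-+ n _ _)
  where
  offDiagonal-+ : ∀ x y → offDiagonal (λ x y → f x y + g x y) x y ≡ offDiagonal f x y + offDiagonal g x y
  offDiagonal-+ x y with x ≟ y
  ... | yes _ = refl
  ... | no _  = refl

pairSum-pointMass : ∀ {n} {a b : Fin n} → a ≢ b → pairSum (pointMass (a , b)) ≡ 1
pairSum-pointMass {n} {a} {b} a≢b =
  trans (sumFin-cong n λ x → sumFin-cong n (offDiagonal-pointMass x)) (doubleSum-pointMass (a , b))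
  where
  offDiagonal-pointMass : ∀ x y → offDiagonal (pointMass (a , b)) x y ≡ pointMass (a , b) x y
  offDiagonal-pointMass x y with x ≟ y
  ... | yes refl = sym (pointMass-≢ λ xx≡ab → a≢b (trans (sym (cong proj₁ xx≡ab)) (cong proj₂ xx≡ab)))
  ... | no _     = refl

_≟²_ : ∀ {n} → (p q : Fin n × Fin n) → Dec (p ≡ q)
_≟²_ = ≡-dec _≟_ _≟_

≢-swap : ∀ {A : Set} {a b c d : A} → (a , b) ≢ (c , d) → (b , a) ≢ (d , c)
≢-swap ab≢cd ba≡dc = ab≢cd (cong swap ba≡dc)

pairSum-<-by-exchange : ∀ {n} {κ κ' : Fin n → Fin n → ℕ} {a b p q r s : Fin n} →
  a ≢ b → p ≢ q → r ≢ s → (p , q) ≢ (a , b) → (r , s) ≢ (a , b) → (p , q) ≢ (r , s) →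
  (∀ x y → x ≢ y → (x , y) ≢ (a , b) → κ x y ≤ κ' x y) →
  κ a b ≤ suc (κ' a b) → κ p q < κ' p q → κ r s < κ' r s →
  pairSum κ < pairSum κ'
pairSum-<-by-exchange {κ = κ} {κ'} {a} {b} {p} {q} {r} {s}
  a≢b p≢q r≢s pq≢ab rs≢ab pq≢rs κ≤κ' κab≤ κpq< κrs< =
  ≤-pred (subst₂ _≤_ (+-comm (pairSum κ) 2) (+-comm (pairSum κ') 1) total)
  where
  gain : Fin _ → Fin _ → ℕ
  gain x y = pointMass (p , q) x y + pointMass (r , s) x y

  pairSum-gain : pairSum gain ≡ 2
  pairSum-gain = trans (pairSum-+ (pointMass (p , q)) (pointMass (r , s)))
                       (cong₂ _+_ (pairSum-pointMass p≢q) (pairSum-pointMass r≢s))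

  total : pairSum κ + 2 ≤ pairSum κ' + 1
  total = subst₂ _≤_ (trans (pairSum-+ κ gain) (cong (pairSum κ +_) pairSum-gain))
                     (trans (pairSum-+ κ' _) (cong (pairSum κ' +_) (pairSum-pointMass a≢b)))
                     (pairSum-mono pointwise)
    where
    pointwise : ∀ x y → x ≢ y → κ x y + gain x y ≤ κ' x y + pointMass (a , b) x y
    pointwise x y x≢y with (x , y) ≟² (a , b) | (x , y) ≟² (p , q) | (x , y) ≟² (r , s)
    ... | yes refl | _ | _
      rewrite pointMass-refl a b | pointMass-≢ (≢-sym pq≢ab) | pointMass-≢ (≢-sym rs≢ab)
            | +-identityʳ (κ a b) | +-comm (κ' a b) 1 = κab≤
    ... | no xy≢ab | yes refl | _
      rewrite pointMass-≢ xy≢ab | pointMass-refl p q | pointMass-≢ pq≢rs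
            | +-identityʳ (κ' p q) | +-comm (κ p q) 1 = κpq<
    ... | no xy≢ab | no xy≢pq | yes refl
      rewrite pointMass-≢ xy≢ab | pointMass-≢ xy≢pq | pointMass-refl r s
            | +-identityʳ (κ' r s) | +-comm (κ r s) 1 = κrs<
    ... | no xy≢ab | no xy≢pq | no xy≢rs
      rewrite pointMass-≢ xy≢ab | pointMass-≢ xy≢pq | pointMass-≢ xy≢rs
            | +-identityʳ (κ x y) | +-identityʳ (κ' x y) = κ≤κ' x y x≢y xy≢ab

open RawMonad (¬¬-Monad {a = 0ℓ}) using (pure; _>>=_; rawApplicative)

¬¬-maximum : (P : ℕ → Set) → P 0 → ∀ B → (∀ m → P m → m ≤ B) →
  ¬ ¬ (∃ λ k → P k × (∀ m → P m → m ≤ k))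
¬¬-maximum P p0 zero    ≤0   = pure (0 , p0 , ≤0)
¬¬-maximum P p0 (suc B) ≤1+B = ¬¬-excluded-middle {A = P (suc B)} >>= λ where
  (yes p1+B) → pure (suc B , p1+B , ≤1+B)
  (no ¬p1+B) → ¬¬-maximum P p0 B λ m pm → ≤-pred (≤∧≢⇒< (≤1+B m pm) λ { refl → ¬p1+B pm })

module _ {n} {G : Graph n} (E : Orientation G) where

  arc⇒≢ : ∀ {x y} → arc E x y ≡ true → x ≢ y
  arc⇒≢ {x} xy refl = contradiction (trans (sym (irrefl G x)) (arc-edge E x x xy)) λ ()

  sink-noPathFrom : ∀ {v y xs} → IsSink E v → ¬ PathVia E v y xs
  sink-noPathFrom snk (direct vy) = contradiction (trans (sym (snk _)) vy) λ ()
  sink-noPathFrom snk (via vw _)  = contradiction (trans (sym (snk _)) vw) λ ()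

  source-noPathTo : ∀ {u x xs} → IsSource E u → ¬ PathVia E x u xs
  source-noPathTo src (direct xu) = contradiction (trans (sym (src _)) xu) λ ()
  source-noPathTo src (via _ wu)  = source-noPathTo src wu

  arc⇒isPath : ∀ {x y} → arc E x y ≡ true → IsPath E x y []
  arc⇒isPath xy = direct xy , ((arc⇒≢ xy ∷ []) ∷ [] ∷ [])

  arcs⇒isPath : ∀ {x w y} → arc E x w ≡ true → arc E w y ≡ true → x ≢ y → IsPath E x y (w ∷ [])
  arcs⇒isPath xw wy x≢y = via xw (direct wy) , ((arc⇒≢ xw ∷ x≢y ∷ []) ∷ (arc⇒≢ wy ∷ []) ∷ [] ∷ [])

  isPath⇒hasDisjointPaths : ∀ {x y xs} → IsPath E x y xs → HasDisjointPaths E x y 1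
  isPath⇒hasDisjointPaths p = (λ _ → _) , (λ _ → p) , λ { zero zero 0≢0 → contradiction refl 0≢0 }

  isPath⇒≢ : ∀ {x y xs} → IsPath E x y xs → x ≢ y
  isPath⇒≢ {xs = xs} (_ , x≢ ∷ _) = All.head (++⁻ʳ xs x≢)

  internal≢target : ∀ {x y w xs} → IsPath E x y (w ∷ xs) → w ≢ y
  internal≢target {xs = xs} (_ , _ ∷ (w≢ ∷ _)) = All.head (++⁻ʳ xs w≢)

  successor : Fin n → List (Fin n) → Fin n
  successor y []      = y
  successor y (w ∷ _) = w

  successor-≢ : ∀ {x y xs ys} → IsPath E x y xs → IsPath E x y ys → xs ≢ ys →
    (∀ z → z ∈ xs → z ∈ ys → ⊥) → successor y xs ≢ successor y ys
  successor-≢ {xs = []}    {[]}    _ _ xs≢ys _        _  = xs≢ys refl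
  successor-≢ {xs = []}    {_ ∷ _} _ q _     _        eq = internal≢target q (sym eq)
  successor-≢ {xs = _ ∷ _} {[]}    p _ _     _        eq = internal≢target p eq
  successor-≢ {xs = _ ∷ _} {_ ∷ _} _ _ _     disjoint eq = disjoint _ (here refl) (here eq)

  hasDisjointPaths-≤ : ∀ {x y m} → HasDisjointPaths E x y m → m ≤ n
  hasDisjointPaths-≤ {y = y} (ps , isPath , disjoint) = injective⇒≤ successor-injective
    where
    successor-injective : ∀ {i j} → successor y (ps i) ≡ successor y (ps j) → i ≡ j
    successor-injective {i} {j} eq with i ≟ j
    ... | yes i≡j = i≡j
    ... | no i≢j  = contradiction eq
      (successor-≢ (isPath i) (isPath j) (proj₁ (disjoint i j i≢j)) (proj₂ (disjoint i j i≢j)))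

  ¬¬-isKappa : ∀ x y → ¬ ¬ ∃ (IsKappa E x y)
  ¬¬-isKappa x y = ¬¬-maximum (HasDisjointPaths E x y) ((λ ()) , (λ ()) , (λ ())) n (λ _ → hasDisjointPaths-≤)

  ¬¬-kappaFun : ¬ ¬ ∃ (KappaFun E)
  ¬¬-kappaFun = sequence rawApplicative (λ x → sequence rawApplicative (¬¬-isKappa x)) >>= λ κ →
    pure ((λ x y → proj₁ (κ x y)) , λ x y _ → proj₂ (κ x y))

  isKappa-0 : ∀ {x y k} → IsKappa E x y k → (∀ {xs} → ¬ PathVia E x y xs) → k ≡ 0
  isKappa-0 {k = zero}  _                          _      = refl
  isKappa-0 {k = suc _} ((_ , isPath , _) , _) noPath = contradiction (proj₁ (isPath zero)) noPath

  isKappa-mono : ∀ {G' : Graph n} {E' : Orientation G'} {x y k k'} → IsKappa E x y k → IsKappa E' x y k' →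
    (∀ {m} → HasDisjointPaths E x y m → HasDisjointPaths E' x y m) → k ≤ k'
  isKappa-mono (paths , _) (_ , maximal') embed = maximal' _ (embed paths)

  isKappa-≤-suc : ∀ {G' : Graph n} {E' : Orientation G'} {x y k k'} → IsKappa E x y k → IsKappa E' x y k' →
    (∀ {m} → HasDisjointPaths E x y (suc m) → HasDisjointPaths E' x y m) → k ≤ suc k'
  isKappa-≤-suc {k = zero}  _           _             _     = z≤n
  isKappa-≤-suc {k = suc k} (paths , _) (_ , maximal') embed = s≤s (maximal' k (embed paths))

[]? : ∀ {A : Set} (xs : List A) → Dec (xs ≡ [])
[]? []      = yes refl
[]? (_ ∷ _) = no λ ()

allButOne-nonEmpty : ∀ {A : Set} {m} (xs : Fin (suc m) → List A) → (∀ i j → i ≢ j → xs i ≢ xs j) →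
  ∃ λ i₀ → ∀ j → xs (punchIn i₀ j) ≢ []
allButOne-nonEmpty xs distinct with any? (λ i → []? (xs i))
... | yes (i₀ , xsi₀≡[]) = i₀ , λ j xsj≡[] → distinct _ _ (punchInᵢ≢i i₀ j) (trans xsj≡[] (sym xsi₀≡[]))
... | no noneEmpty      = zero , λ j xsj≡[] → noneEmpty (_ , xsj≡[])

∃-third : ∀ {n} → 3 ≤ n → {u v : Fin n} → u ≢ v → ∃ λ w → w ≢ u × w ≢ v
∃-third (s≤s (s≤s (s≤s _))) {u} {v} u≢v =
  punchIn u (punchIn v′ zero) , punchInᵢ≢i u _ ,
  λ eq → punchInᵢ≢i v′ zero (punchIn-injective u _ _ (trans eq (sym (punchIn-punchOut u≢v))))
  where
  v′ = punchOut u≢v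

reach-exits : ∀ {n} {G : Graph n} {P : Fin n → Set} → (∀ x → Dec (P x)) → ∀ {a z} →
  Reach G a z → P a → ¬ P z → ∃₂ λ s t → P s × ¬ P t × adj G s t ≡ true
reach-exits P? here                 pa ¬pz = contradiction pa ¬pz
reach-exits P? (step {w = b} ab bz) pa ¬pz with P? b
... | yes pb  = reach-exits P? bz pb ¬pz
... | no ¬pb  = _ , b , pa , ¬pb , ab

module Reversal {n} {G : Graph n} (D : Orientation G) {u v : Fin n} (uv : arc D u v ≡ true) where

  data Position (a b : Fin n) : Set where
    forward   : (a , b) ≡ (u , v) → Position a b
    backward  : (a , b) ≡ (v , u) → Position a b
    elsewhere : (a , b) ≢ (u , v) → (a , b) ≢ (v , u) → Position a b

  position : ∀ a b → Position a b
  position a b with (a , b) ≟² (u , v) | (a , b) ≟² (v , u)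
  ... | yes ab≡uv | _         = forward ab≡uv
  ... | no _      | yes ab≡vu = backward ab≡vu
  ... | no ab≢uv  | no ab≢vu  = elsewhere ab≢uv ab≢vu

  reversedArc : ∀ a b → Position a b → Bool
  reversedArc a b (forward _)     = false
  reversedArc a b (backward _)    = true
  reversedArc a b (elsewhere _ _) = arc D a b

  arc′ : Fin n → Fin n → Bool
  arc′ a b = reversedArc a b (position a b)

  arc′-uv : arc′ u v ≡ false
  arc′-uv with position u v
  ... | forward _           = refl
  ... | backward uv≡vu      = contradiction (cong proj₁ uv≡vu) (arc⇒≢ D uv)
  ... | elsewhere uv≢uv _   = contradiction refl uv≢uv

  arc′-vu : arc′ v u ≡ true
  arc′-vu with position v u
  ... | forward vu≡uv       = contradiction (sym (cong proj₁ vu≡uv)) (arc⇒≢ D uv)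
  ... | backward _          = refl
  ... | elsewhere _ vu≢vu   = contradiction refl vu≢vu

  arc′-elsewhere : ∀ {a b} → (a , b) ≢ (u , v) → (a , b) ≢ (v , u) → arc′ a b ≡ arc D a b
  arc′-elsewhere {a} {b} ab≢uv ab≢vu with position a b
  ... | forward ab≡uv   = contradiction ab≡uv ab≢uv
  ... | backward ab≡vu  = contradiction ab≡vu ab≢vu
  ... | elsewhere _ _   = refl

  arc′-edge : ∀ a b → arc′ a b ≡ true → adj G a b ≡ true
  arc′-edge a b ab with position a b
  arc′-edge a b () | forward _
  ... | backward refl   = trans (symm G v u) (arc-edge D u v uv)
  ... | elsewhere _ _   = arc-edge D a b ab

  edge-arc′ : ∀ a b → adj G a b ≡ true → (arc′ a b ≡ true) ⊎ (arc′ b a ≡ true)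
  edge-arc′ a b ab with position a b
  ... | forward refl          = inj₂ arc′-vu
  ... | backward refl         = inj₁ refl
  ... | elsewhere ab≢uv ab≢vu =
    Sum.map₂ (trans (arc′-elsewhere (≢-swap ab≢vu) (≢-swap ab≢uv))) (edge-arc D a b ab)

  antisym′ : ∀ a b → arc′ a b ≡ true → arc′ b a ≡ true → ⊥
  antisym′ a b ab ba with position a b
  antisym′ a b () ba | forward _
  ... | backward refl         = contradiction (trans (sym arc′-uv) ba) λ ()
  ... | elsewhere ab≢uv ab≢vu =
    antisym D a b ab (trans (sym (arc′-elsewhere (≢-swap ab≢vu) (≢-swap ab≢uv))) ba)

  reversed : Orientation G
  reversed = record { arc = arc′ ; arc-edge = arc′-edge ; edge-arc = edge-arc′ ; antisym = antisym′ }

  arc-reversed : ∀ {a b} → arc D a b ≡ true → (a , b) ≢ (u , v) → arc reversed a b ≡ true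
  arc-reversed {a} {b} ab ab≢uv = trans (arc′-elsewhere ab≢uv λ { refl → antisym D v u ab uv }) ab

  module _ (src : IsSource D u) (snk : IsSink D v) where

    pathVia-reversed : ∀ {x y xs} → PathVia D x y xs → (xs ≡ [] → (x , y) ≢ (u , v)) → PathVia reversed x y xs
    pathVia-reversed (direct xy) direct≢uv = direct (arc-reversed xy (direct≢uv refl))
    pathVia-reversed (via xw wy) _ =
      via (arc-reversed xw λ { refl → sink-noPathFrom D snk wy })
          (pathVia-reversed wy λ { _ refl → source-noPathTo D src (direct xw) })

    hasDisjointPaths-reversed : ∀ {x y k} → (x , y) ≢ (u , v) →
      HasDisjointPaths D x y k → HasDisjointPaths reversed x y k
    hasDisjointPaths-reversed xy≢uv (ps , isPath , disjoint) =
      ps , (λ i → Product.map₁ (λ p → pathVia-reversed p λ _ → xy≢uv) (isPath i)) , disjoint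

    -- Only the direct path uses the reversed arc, and the paths are distinct, so at most one is direct.
    hasDisjointPaths-reversed-uv : ∀ {k} → HasDisjointPaths D u v (suc k) → HasDisjointPaths reversed u v k
    hasDisjointPaths-reversed-uv (ps , isPath , disjoint)
      with allButOne-nonEmpty ps (λ i j i≢j → proj₁ (disjoint i j i≢j))
    ... | i₀ , nonEmpty =
      (λ j → ps (punchIn i₀ j)) ,
      (λ j → Product.map₁ (λ p → pathVia-reversed p (λ empty → contradiction empty (nonEmpty j)))
                          (isPath (punchIn i₀ j))) ,
      (λ i j i≢j → disjoint _ _ (λ eq → i≢j (punchIn-injective i₀ i j eq)))

    Gain : Fin n → Fin n → Set
    Gain r s = (∀ {xs} → ¬ PathVia D r s xs) × HasDisjointPaths reversed r s 1

    gain-vu : Gain v u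
    gain-vu = sink-noPathFrom D snk , isPath⇒hasDisjointPaths reversed (arc⇒isPath reversed arc′-vu)

    second-gain : 3 ≤ n → Connected G → ∃₂ λ r s → (r , s) ≢ (v , u) × Gain r s
    second-gain n≥3 connected with ∃-third n≥3 (arc⇒≢ D uv)
    ... | w , w≢u , w≢v
      with reach-exits (λ x → x ≟ u ⊎-dec x ≟ v) (connected u w) (inj₁ refl) Sum.[ w≢u , w≢v ]
    ... | s , t , inj₁ refl , t∉uv , ut with edge-arc D u t ut
    ...   | inj₁ u→t = v , t , (λ eq → t∉uv (inj₁ (cong proj₂ eq))) , sink-noPathFrom D snk ,
      isPath⇒hasDisjointPaths reversed
        (arcs⇒isPath reversed arc′-vu (arc-reversed u→t λ eq → t∉uv (inj₂ (cong proj₂ eq)))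
                     λ { refl → t∉uv (inj₂ refl) })
    ...   | inj₂ t→u = contradiction (direct t→u) (source-noPathTo D src)
    second-gain n≥3 connected | w , w≢u , w≢v | s , t , inj₂ refl , t∉uv , vt with edge-arc D v t vt
    ...   | inj₁ v→t = contradiction (direct v→t) (sink-noPathFrom D snk)
    ...   | inj₂ t→v = t , u , (λ eq → t∉uv (inj₂ (cong proj₁ eq))) , source-noPathTo D src ,
      isPath⇒hasDisjointPaths reversed
        (arcs⇒isPath reversed (arc-reversed t→v λ eq → t∉uv (inj₁ (cong proj₁ eq))) arc′-vu
                     λ { refl → t∉uv (inj₁ refl) })

    reversal-increases-pairSum : 3 ≤ n → Connected G → ∀ {κ κ'} → KappaFun D κ → KappaFun reversed κ' →
      pairSum κ < pairSum κ'
    reversal-increases-pairSum n≥3 connected {κ} {κ'} κ-D κ-rev with second-gain n≥3 connected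
    ... | r , s , rs≢vu , gain-rs =
      pairSum-<-by-exchange u≢v (gain-≢ gain-vu) (gain-≢ gain-rs)
        (gain-≢uv gain-vu) (gain-≢uv gain-rs) (≢-sym rs≢vu)
        kept lost-uv (gain-< gain-vu) (gain-< gain-rs)
      where
      u≢v : u ≢ v
      u≢v = arc⇒≢ D uv

      gain-≢ : ∀ {r s} → Gain r s → r ≢ s
      gain-≢ (_ , _ , isPath , _) = isPath⇒≢ reversed (isPath zero)

      gain-≢uv : ∀ {r s} → Gain r s → (r , s) ≢ (u , v)
      gain-≢uv (noPath , _) refl = noPath (direct uv)

      gain-< : ∀ {r s} → Gain r s → κ r s < κ' r s
      gain-< {r} {s} gain@(noPath , path) =
        subst (_< κ' r s) (sym (isKappa-0 D (κ-D r s (gain-≢ gain)) noPath))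
                          (proj₂ (κ-rev r s (gain-≢ gain)) 1 path)

      kept : ∀ x y → x ≢ y → (x , y) ≢ (u , v) → κ x y ≤ κ' x y
      kept x y x≢y xy≢uv = isKappa-mono D (κ-D x y x≢y) (κ-rev x y x≢y) (hasDisjointPaths-reversed xy≢uv)

      lost-uv : κ u v ≤ suc (κ' u v)
      lost-uv = isKappa-≤-suc D (κ-D u v u≢v) (κ-rev u v u≢v) hasDisjointPaths-reversed-uv

lemma4p4 : ∀ {n : ℕ} (G : Graph n) → 3 ≤ n → Connected G →
    (D : Orientation G) → Optimal D →
    ∀ u v → arc D u v ≡ true → ¬ (IsSource D u × IsSink D v)
lemma4p4 G n≥3 connected D optimal u v uv (src , snk) =
  ¬¬-kappaFun D λ (κ , κ-D) → ¬¬-kappaFun reversed λ (κ' , κ-rev) →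
    ≤⇒≯ (optimal reversed κ κ' κ-D κ-rev) (reversal-increases-pairSum src snk n≥3 connected κ-D κ-rev)
  where
  open Reversal D uv
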